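{- Let $T$ be a quadrangular tournament with a vertex $x$ of out-degree $1$, and let $y$ be the vertex with $x\rightarrow y$. Then $O(y)=V(T)\setminus\{x,y\}$.
   Context: A tournament $T$ is a loopless digraph in which for each pair of distinct vertices exactly one of $(u,v)$, $(v,u)$ is an arc; $u\rightarrow v$ means $(u,v)$ is an arc. $O(v)=\{u:v\rightarrow u\}$, $I(v)=\{u:u\rightarrow v\}$. A digraph is quadrangular if for all distinct vertices $u,v$, $|O(u)\cap O(v)|\neq 1$ and $|I(u)\cap I(v)|\neq 1$. -}

module Defs where

open import Data.Nat using (ℕ)
open import Data.Bool using (Bool; true; false; _∧_)
open import Data.Fin using (Fin)
open import Data.List using (List; length; filterᵇ)
open import Data.List using () renaming (allFin to allFinL)
open import Relation.Binary.PropositionalEquality using (_≡_; _≢_)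
open import Data.Sum using (_⊎_)
open import Data.Product using (_×_)

-- A digraph on vertex set Fin n, given by its (Boolean) arc relation:
-- arc u v ≡ true  means  u → v.
Digraph : ℕ → Set
Digraph n = Fin n → Fin n → Bool

record IsTournament {n : ℕ} (T : Digraph n) : Set where
  field
    loopless : ∀ v → T v v ≡ false
    total    : ∀ u v → u ≢ v → T u v ≡ true ⊎ T v u ≡ true
    antisym  : ∀ u v → T u v ≡ true → T v u ≡ false

vertices : (n : ℕ) → List (Fin n)
vertices n = allFinL n

outDeg : {n : ℕ} → Digraph n → Fin n → ℕ
outDeg {n} T v = length (filterᵇ (λ w → T v w) (vertices n))

commonOut : {n : ℕ} → Digraph n → Fin n → Fin n → ℕ
commonOut {n} T u v = length (filterᵇ (λ w → T u w ∧ T v w) (vertices n))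

commonIn : {n : ℕ} → Digraph n → Fin n → Fin n → ℕ
commonIn {n} T u v = length (filterᵇ (λ w → T w u ∧ T w v) (vertices n))

IsQuadrangular : {n : ℕ} → Digraph n → Set
IsQuadrangular T = ∀ u v → u ≢ v → (commonOut T u v ≢ 1) × (commonIn T u v ≢ 1)

{-# OPTIONS --safe #-}
-- If some z ∉ {x, y} had z → y, then y would be a common out-neighbour of x and z.
-- As y is the only out-neighbour of x, this gives |O(x) ∩ O(z)| = 1, which
-- quadrangularity forbids; so by totality y → z.
module Submission where

open import Defs
open import Data.Nat using (ℕ; _≤_; _<_)
open import Data.Nat.Properties using (≤-antisym)
open import Data.Bool using (Bool; true; T; T?)
open import Data.Bool.Properties using (T-∧; T-≡)
open import Data.Fin using (Fin)
open import Data.List using (List; length; filterᵇ)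
open import Data.List.Properties using (filter-some)
open import Data.List.Membership.Propositional using (_∈_; lose)
open import Data.List.Membership.Propositional.Properties using (∈-allFin)
open import Data.List.Relation.Binary.Sublist.Propositional using (⊆-refl)
open import Data.List.Relation.Binary.Sublist.Propositional.Properties using (filter⁺; length-mono-≤)
open import Data.Product using (_×_; _,_; proj₁)
open import Data.Sum using (inj₁; inj₂)
open import Function using (_∘_)
open import Function.Bundles using (_⇔_; mk⇔; Equivalence)
open import Relation.Nullary using (contradiction)
open import Relation.Binary.PropositionalEquality using (_≡_; _≢_; refl; sym; trans; subst; ≢-sym)

length-filterᵇ-mono : {A : Set} {p q : A → Bool} → (∀ {a} → T (p a) → T (q a)) →
  (xs : List A) → length (filterᵇ p xs) ≤ length (filterᵇ q xs)
length-filterᵇ-mono {p = p} {q} p⇒q xs =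
  length-mono-≤ (filter⁺ (T? ∘ p) (T? ∘ q) (λ { refl → p⇒q }) (⊆-refl {x = xs}))

length-filterᵇ-pos : {A : Set} {p : A → Bool} {x : A} {xs : List A} →
  x ∈ xs → T (p x) → 0 < length (filterᵇ p xs)
length-filterᵇ-pos {p = p} x∈xs px = filter-some (T? ∘ p) (lose x∈xs px)

module _ {n : ℕ} (G : Digraph n) where

  commonOut≤outDeg : (u v : Fin n) → commonOut G u v ≤ outDeg G u
  commonOut≤outDeg u v = length-filterᵇ-mono (proj₁ ∘ Equivalence.to T-∧) (vertices n)

  commonOut-pos : {u v w : Fin n} → G u w ≡ true → G v w ≡ true → 0 < commonOut G u v
  commonOut-pos {w = w} u→w v→w =
    length-filterᵇ-pos (∈-allFin w) (from T-∧ (from T-≡ u→w , from T-≡ v→w))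
    where open Equivalence using (from)

  outDeg≡1⇒commonOut≡1 : {u v w : Fin n} → outDeg G u ≡ 1 →
    G u w ≡ true → G v w ≡ true → commonOut G u v ≡ 1
  outDeg≡1⇒commonOut≡1 {u} {v} outDeg≡1 u→w v→w =
    ≤-antisym (subst (commonOut G u v ≤_) outDeg≡1 (commonOut≤outDeg u v)) (commonOut-pos u→w v→w)

module _ {n : ℕ} {G : Digraph n} (tournament : IsTournament G) where
  open IsTournament tournament

  arc⇒≢ : {u v : Fin n} → G u v ≡ true → u ≢ v
  arc⇒≢ {u} u→v refl with () ← trans (sym (loopless u)) u→v

  arc⇒¬reverse : {u v : Fin n} → G u v ≡ true → G v u ≢ true
  arc⇒¬reverse u→v v→u with () ← trans (sym (antisym _ _ u→v)) v→u

lemma5 : {n : ℕ} (T : Digraph n) → IsTournament T → IsQuadrangular T →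
    (x y : Fin n) → outDeg T x ≡ 1 → T x y ≡ true →
    ∀ z → (T y z ≡ true) ⇔ ((z ≢ x) × (z ≢ y))
lemma5 T tournament quadrangular x y outDeg≡1 x→y z = mk⇔ forward backward
  where
    open IsTournament tournament

    forward : T y z ≡ true → (z ≢ x) × (z ≢ y)
    forward y→z = (λ { refl → arc⇒¬reverse tournament x→y y→z }) , ≢-sym (arc⇒≢ tournament y→z)

    backward : (z ≢ x) × (z ≢ y) → T y z ≡ true
    backward (z≢x , z≢y) with total y z (≢-sym z≢y)
    ... | inj₁ y→z = y→z
    ... | inj₂ z→y = contradiction (outDeg≡1⇒commonOut≡1 T outDeg≡1 x→y z→y)
                                   (proj₁ (quadrangular x z (≢-sym z≢x)))
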